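{- If $q \geq 3$, then $f(q,q) \leq 2q-1$.
   Context: For integers $n \geq 1$ and $q \geq 2$, let $\mathbb Z_q = \mathbb Z/q\mathbb Z$ and consider $\mathbb Z_q^n$ with the Hamming distance $d(x,y)$ = number of coordinates in which $x$ and $y$ differ. Say $x$ skirts $y$ if $d(x,y) = n$. A set $S \subseteq \mathbb Z_q^n$ is a skirting set if every $y \in \mathbb Z_q^n$ is skirted by some $x \in S$. Let $f(n,q)$ denote the minimum size of a skirting set in $\mathbb Z_q^n$. -}

module Defs where

open import Data.Nat using (ℕ; zero; suc)
open import Data.Fin using (Fin)
open import Data.Fin.Properties using (_≟_)
open import Data.Vec using (Vec; []; _∷_)
open import Data.List using (List)
open import Data.List.Relation.Unary.Any using (Any)
open import Relation.Nullary using (yes; no)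
open import Relation.Binary.PropositionalEquality using (_≡_)

Word : ℕ → ℕ → Set
Word n q = Vec (Fin q) n

hamming : ∀ {n q} → Word n q → Word n q → ℕ
hamming [] [] = zero
hamming (a ∷ x) (b ∷ y) with a ≟ b
... | yes _ = hamming x y
... | no _ = suc (hamming x y)

Skirts : ∀ {n q} → Word n q → Word n q → Set
Skirts {n} x y = hamming x y ≡ n

-- S is a skirting set: every y is skirted by some x ∈ S.
-- (S is given as a finite list; its size is bounded by the list length.)
IsSkirting : ∀ {n q} → List (Word n q) → Set
IsSkirting {n} {q} S = (y : Word n q) → Any (λ x → Skirts x y) S

-- Take the q − 1 constant words with a nonzero letter together with the q "spikes",
-- which are 1 in one position j and 0 elsewhere.  If some nonzero letter is missing
-- from y, the constant word of that letter skirts y.  Otherwise every nonzero letter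
-- occurs, so 0 occurs at most once (q positions cannot carry q distinct letters and a
-- repeated one).  If 0 occurs at position j, the spike at j skirts y; if it does not
-- occur, the spike at a position carrying the letter 2 (here q ≥ 3 is used) does.
module Submission where

open import Defs
open import Data.Nat using (ℕ; _≤_; _+_; _*_; _∸_)
open import Data.List using (List; length)
open import Data.Product using (Σ; _×_)

open import Data.Nat using (suc; s≤s)
open import Data.Nat.Properties using (n<1+n; ≤-reflexive; +-identityʳ)
open import Data.Fin using (Fin; zero; suc; punchOut)
open import Data.Fin.Properties using (_≟_; 0≢1+n; suc-injective; any?; all?; ¬∀⟶∃¬; pigeonhole; punchOut-injective; <⇒≢)
open import Data.Vec using ([]; _∷_; lookup; replicate; tabulate)
open import Data.Vec.Properties using (lookup-replicate; lookup∘tabulate)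
import Data.List as List
open import Data.List.Properties using (length-++; length-tabulate)
open import Data.List.Relation.Unary.Any.Properties using (++⁺ˡ; ++⁺ʳ; tabulate⁺)
open import Data.Product using (_,_; ∃)
open import Function using (_∘_)
open import Relation.Nullary using (yes; no; contradiction)
open import Relation.Binary.PropositionalEquality using (_≡_; _≢_; refl; sym; trans; cong; cong₂; module ≡-Reasoning)

differs-everywhere⇒skirts : ∀ {n q} (x y : Word n q) →
  (∀ i → lookup x i ≢ lookup y i) → Skirts x y
differs-everywhere⇒skirts [] [] _ = refl
differs-everywhere⇒skirts (a ∷ x) (b ∷ y) differs with a ≟ b
... | yes a≡b = contradiction a≡b (differs zero)
... | no _ = cong suc (differs-everywhere⇒skirts x y (differs ∘ suc))

surjective⇒injective : ∀ {n} (f : Fin n → Fin n) → (∀ c → ∃ λ k → f k ≡ c) →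
  ∀ {i j} → f i ≡ f j → i ≡ j
surjective⇒injective {suc n} f surjective {i} {j} fi≡fj with i ≟ j
... | yes i≡j = i≡j
... | no i≢j =
  let a , b , a<b , same = pigeonhole (n<1+n n) punched
  in contradiction (same-preimage a b same) (<⇒≢ a<b)
  where
  -- Every letter has a preimage other than j: for f j itself, the preimage i.
  preimage-avoiding : ∀ c → ∃ λ k → j ≢ k × f k ≡ c
  preimage-avoiding c with c ≟ f j
  ... | yes c≡fj = i , i≢j ∘ sym , trans fi≡fj (sym c≡fj)
  ... | no c≢fj with surjective c
  ...   | k , fk≡c = k , (λ { refl → c≢fj (sym fk≡c) }) , fk≡c

  punched : Fin (suc n) → Fin n
  punched c with preimage-avoiding c
  ... | _ , j≢k , _ = punchOut j≢k

  same-preimage : ∀ a b → punched a ≡ punched b → a ≡ b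
  same-preimage a b same with preimage-avoiding a | preimage-avoiding b
  ... | ka , j≢ka , fka≡a | kb , j≢kb , fkb≡b =
    trans (sym fka≡a) (trans (cong f (punchOut-injective j≢ka j≢kb same)) fkb≡b)

module SkirtingSet (r : ℕ) where

  q : ℕ
  q = suc (suc (suc r))

  constant : Fin (suc (suc r)) → Word q q
  constant c = replicate q (suc c)

  spike-letter : Fin q → Fin q → Fin q
  spike-letter j i with i ≟ j
  ... | yes _ = suc zero
  ... | no _ = zero

  spike : Fin q → Word q q
  spike j = tabulate (spike-letter j)

  skirting-set : List (Word q q)
  skirting-set = List.tabulate constant List.++ List.tabulate spike

  constant-skirts : ∀ y c → (∀ i → lookup y i ≢ suc c) → Skirts (constant c) y
  constant-skirts y c absent = differs-everywhere⇒skirts (constant c) y differs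
    where
    differs : ∀ i → lookup (constant c) i ≢ lookup y i
    differs i rewrite lookup-replicate i (suc c) = absent i ∘ sym

  spike-skirts : ∀ y j → lookup y j ≢ suc zero → (∀ i → i ≢ j → lookup y i ≢ zero) →
    Skirts (spike j) y
  spike-skirts y j yj≢1 others≢0 = differs-everywhere⇒skirts (spike j) y differs
    where
    differs : ∀ i → lookup (spike j) i ≢ lookup y i
    differs i rewrite lookup∘tabulate (spike-letter j) i with i ≟ j
    ... | yes refl = yj≢1 ∘ sym
    ... | no i≢j = others≢0 i i≢j ∘ sym

  spike-position : ∀ y → (∀ (c : Fin (suc (suc r))) → ∃ λ i → lookup y i ≡ suc c) →
    ∃ λ j → lookup y j ≢ suc zero × (∀ i → i ≢ j → lookup y i ≢ zero)
  spike-position y occurs with any? (λ j → lookup y j ≟ zero)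
  ... | no zero-absent =
    let k , yk≡2 = occurs (suc zero)
    in k , (λ yk≡1 → 0≢1+n (sym (suc-injective (trans (sym yk≡2) yk≡1))))
         , (λ i _ yi≡0 → zero-absent (i , yi≡0))
  ... | yes (j , yj≡0) =
    j , (λ yj≡1 → 0≢1+n (trans (sym yj≡0) yj≡1))
      , (λ i i≢j yi≡0 → i≢j (surjective⇒injective (lookup y) surjective (trans yi≡0 (sym yj≡0))))
    where
    surjective : ∀ c → ∃ λ k → lookup y k ≡ c
    surjective zero = j , yj≡0
    surjective (suc c) = occurs c

  isSkirting : IsSkirting skirting-set
  isSkirting y with all? (λ (c : Fin (suc (suc r))) → any? (λ i → lookup y i ≟ suc c))
  ... | no some-absent
    with ¬∀⟶∃¬ _ _ (λ c → any? (λ i → lookup y i ≟ suc c)) some-absent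
  ...   | c , absent =
    ++⁺ˡ (tabulate⁺ {f = constant} c (constant-skirts y c (λ i yi≡c → absent (i , yi≡c))))
  isSkirting y | yes occurs with spike-position y occurs
  ...   | j , yj≢1 , others≢0 =
    ++⁺ʳ (List.tabulate constant) (tabulate⁺ {f = spike} j (spike-skirts y j yj≢1 others≢0))

  length-skirting-set : length skirting-set ≡ 2 * q ∸ 1
  length-skirting-set = begin
    length skirting-set
      ≡⟨ length-++ (List.tabulate constant) ⟩
    length (List.tabulate constant) + length (List.tabulate spike)
      ≡⟨ cong₂ _+_ (length-tabulate constant) (length-tabulate spike) ⟩
    suc (suc r) + q
      ≡⟨ cong (suc (suc r) +_) (sym (+-identityʳ q)) ⟩
    2 * q ∸ 1
      ∎
    where open ≡-Reasoning

lemma3p1 : (q : ℕ) → 3 ≤ q →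
    Σ (List (Word q q)) (λ S → IsSkirting S × length S ≤ 2 * q ∸ 1)
lemma3p1 (suc (suc (suc r))) (s≤s (s≤s (s≤s _))) =
  skirting-set , isSkirting , ≤-reflexive length-skirting-set
  where open SkirtingSet r
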